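{- Let $m\ge 2$ and $t\ge m$ be integers. Assume ${\rm DHL}^*(t;m)$ holds, and assume there exist a rational number $y$ and distinct positive integers $a_1,\ldots,a_t$ with \[\frac{\sigma(a_1)}{a_1}=\cdots=\frac{\sigma(a_t)}{a_t}=y.\] Then there exist positive integers $h_1<h_2<\cdots<h_m$ such that the set of positive integers $\ell$ for which the simultaneous equations \[\sigma(n+\ell h_1)=\sigma(n+\ell h_2)=\cdots=\sigma(n+\ell h_m)\] have infinitely many solutions $n\in\mathbb{N}$ has positive lower asymptotic density.
   Context: $\sigma(n)$ denotes the sum of the positive divisors of $n$. A collection of linear forms $(a_1n+b_1,\ldots,a_Kn+b_K)$ with integer coefficients is called admissible if $a_i>0$ for each $i$, the forms are pairwise distinct, and there is no prime $p$ dividing the product $(a_1n+b_1)\cdots(a_Kn+b_K)$ for every integer $n$. For positive integers $K\ge m$, the statement ${\rm DHL}^*(K;m)$ means: for every admissible collection of $K$ linear forms $(a_1n+b_1,\ldots,a_Kn+b_K)$ there exist distinct indices $i_1,\ldots,i_m\in\{1,\ldots,K\}$ such that there are infinitely many integers $r$ for which the $m$ numbers $a_{i_1}r+b_{i_1},\ldots,a_{i_m}r+b_{i_m}$ are simultaneously prime. -}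

module Defs where

open import Data.Nat as ℕ using (ℕ; zero; suc; _+_; _*_; _≤_; _<_)
open import Data.Nat.Divisibility using (_∣?_)
open import Data.Nat.Primality using (Prime)
open import Data.Integer as ℤ using (ℤ; +_)
open import Data.Integer.Divisibility as ℤD using ()
open import Data.Fin using (Fin)
import Data.Fin as Fin
open import Data.Nat.ListAction using (sum)
open import Data.List using (List; map; filter; upTo; length)
open import Data.List.Relation.Unary.All using (All)
open import Data.List.Relation.Unary.Unique.Propositional using (Unique)
open import Data.Product using (Σ; ∃; ∃-syntax; _×_; _,_)
open import Relation.Binary.PropositionalEquality using (_≡_; _≢_)
open import Relation.Nullary using (¬_)

-- σ(n) = sum of the positive divisors of n (σ 0 = 0, irrelevant here)
σ : ℕ → ℕ
σ n = sum (filter (_∣? n) (map suc (upTo n)))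

prodFin : ∀ {K} → (Fin K → ℤ) → ℤ
prodFin {zero} f = + 1
prodFin {suc K} f = f Fin.zero ℤ.* prodFin (λ i → f (Fin.suc i))

IsPrimeℤ : ℤ → Set
IsPrimeℤ z = ∃[ p ] (Prime p × z ≡ + p)

Admissible : ∀ {K} → (Fin K → ℤ) → (Fin K → ℤ) → Set
Admissible {K} a b =
  (∀ i → ℤ.+0 ℤ.< a i)
  × (∀ i j → i ≢ j → (a i , b i) ≢ (a j , b j))
  × (∀ p → Prime p → ¬ (∀ (n : ℤ) → (+ p) ℤD.∣ prodFin (λ i → a i ℤ.* n ℤ.+ b i)))

DHL* : ℕ → ℕ → Set
DHL* K m =
  (a b : Fin K → ℤ) → Admissible a b →
  Σ (Fin m → Fin K) λ idx → ((∀ (j k : Fin m) → idx j ≡ idx k → j ≡ k)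
    × (∀ (M : ℕ) → ∃[ r ] (M < ℤ.∣ r ∣ × (∀ j → IsPrimeℤ (a (idx j) ℤ.* r ℤ.+ b (idx j))))))

Good : ∀ {m} → (Fin m → ℕ) → ℕ → Set
Good h ℓ = ∀ (M : ℕ) → ∃[ n ] (M < n × (∀ i j → σ (n + ℓ * h i) ≡ σ (n + ℓ * h j)))

-- a set S of positive integers has positive lower asymptotic density:
-- there are δ = 1/(k+1) > 0 and N₀ with #(S ∩ [1,N]) ≥ δ N for all N ≥ N₀
-- (the cardinality bound is witnessed by a duplicate-free list of elements)
PosLowerDensity : (ℕ → Set) → Set
PosLowerDensity S =
  ∃[ k ] ∃[ N₀ ] (∀ N → N₀ ≤ N →
    ∃[ L ] (Unique L × All (λ ℓ → 1 ≤ ℓ × ℓ ≤ N × S ℓ) L × N ≤ suc k * length L))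

{-# OPTIONS --safe #-}
module Submission where

-- Let P be a common multiple of the a_i and c_i = P / a_i. The forms c_i n - 1 are admissible
-- (their product is ±1 at n = 0), so DHL*(t;m) yields m of them, ordered so that a_1 > ... > a_m,
-- whose values q_k = c_k s - 1 are simultaneously prime for infinitely many s. With
-- h_k = P + 1 - a_k, ℓ ≡ 1 (mod P) and n = ℓ (P s - P - 1) we get n + ℓ h_k = ℓ a_k q_k, a product
-- of pairwise coprime factors once s is large, so σ(n + ℓ h_k) = σ(ℓ) σ(a_k) (q_k + 1) = σ(ℓ) y P s
-- does not depend on k. The progression ℓ ≡ 1 (mod P) has density 1/P.

open import Defs
open import Data.Nat
  using (ℕ; zero; suc; _+_; _*_; _∸_; _≤_; _<_; _≤?_; pred; NonZero; s≤s; z≤n; ≢-nonZero; ≢-nonZero⁻¹)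
open import Data.Nat.Properties
open import Data.Nat.Divisibility
open import Data.Nat.DivMod using (m*[n/m]≡n) renaming (_/_ to _div_)
open import Data.Nat.GCD using (gcd; gcd[m,n]∣m; gcd[m,n]∣n; gcd[m,n]≢0)
open import Data.Nat.Coprimality as Coprime using (Coprime; coprime-/gcd; coprime-divisor; prime⇒coprime)
open import Data.Nat.Primality using (Prime; ¬prime[1]; prime⇒irreducible; prime⇒nonZero)
open import Data.Nat.ListAction using (sum; product)
open import Data.Nat.ListAction.Properties using (sum-↭; sum-++; ∈⇒∣product; product≢0)
open import Data.Nat.Tactic.RingSolver using (solve-∀)
open import Data.Integer as ℤ using (ℤ; +_; -[1+_]; -1ℤ)
import Data.Integer.Properties as ℤ
import Data.Integer.Divisibility as ℤ
open import Data.Rational using (ℚ; _/_)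
open import Data.Rational.Properties using (normalize-injective-≃)
open import Data.Fin as Fin using (Fin; punchIn)
open import Data.Fin.Properties using (punchIn-injective; punchInᵢ≢i)
open import Data.List using (List; []; _∷_; map; filter; upTo; tabulate; cartesianProduct; _++_; length)
open import Data.List.Properties using (map-++; map-∘; length-map; length-upTo)
open import Data.List.Membership.Propositional using (_∈_)
open import Data.List.Membership.Propositional.Properties
  using (∈-filter⁺; ∈-filter⁻; ∈-map⁺; ∈-map⁻; ∈-upTo⁺; ∈-upTo⁻; ∈-tabulate⁺; ∈-cartesianProduct⁺; ∈-cartesianProduct⁻)
open import Data.List.Membership.Propositional.Properties.WithK using (unique∧set⇒bag)
open import Data.List.Relation.Binary.BagAndSetEquality using (∼bag⇒↭)
open import Data.List.Relation.Unary.All as All using (All; []; _∷_)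
import Data.List.Relation.Unary.All.Properties as All
open import Data.List.Relation.Unary.Any using (here; there)
open import Data.List.Relation.Unary.Unique.Propositional using (Unique; []; _∷_)
import Data.List.Relation.Unary.Unique.Propositional.Properties as Unique
open import Data.Product using (Σ; ∃₂; ∃-syntax; _×_; _,_; proj₁; proj₂; uncurry)
open import Data.Sum using (inj₁; inj₂)
open import Function using (_∘_)
open import Function.Bundles using (mk⇔)
open import Relation.Binary.PropositionalEquality
open import Relation.Nullary using (¬_; yes; no)
open import Data.Empty using (⊥-elim)

divisors : ℕ → List ℕ
divisors n = filter (_∣? n) (map suc (upTo n))

divisors-unique : ∀ n → Unique (divisors n)
divisors-unique n = Unique.filter⁺ (_∣? n) (Unique.map⁺ suc-injective (Unique.upTo⁺ n))

∈-divisors⁻ : ∀ {n d} → d ∈ divisors n → d ∣ n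
∈-divisors⁻ {n} d∈ = proj₂ (∈-filter⁻ (_∣? n) {xs = map suc (upTo n)} d∈)

∈-divisors⁺ : ∀ {n d} .{{_ : NonZero n}} → d ∣ n → d ∈ divisors n
∈-divisors⁺ {n} {zero}  0∣n = ⊥-elim (≢-nonZero⁻¹ n (0∣⇒≡0 0∣n))
∈-divisors⁺ {n} {suc d} d∣n = ∈-filter⁺ (_∣? n) (∈-map⁺ suc (∈-upTo⁺ (∣⇒≤ d∣n))) d∣n

sum≡σ : ∀ {n} {ds : List ℕ} .{{_ : NonZero n}} → Unique ds →
        (∀ {d} → d ∈ ds → d ∣ n) → (∀ {d} → d ∣ n → d ∈ ds) → sum ds ≡ σ n
sum≡σ {n} ds! ∈⇒∣ ∣⇒∈ = sum-↭ (∼bag⇒↭ (unique∧set⇒bag ds! (divisors-unique n)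
  (mk⇔ (∈-divisors⁺ ∘ ∈⇒∣) (∣⇒∈ ∘ ∈-divisors⁻))))

σ-prime : ∀ {q} → Prime q → σ q ≡ suc q
σ-prime {q} q-prime = trans (sym (sum≡σ {{prime⇒nonZero q-prime}} unique ∈⇒∣ ∣⇒∈)) (cong suc (+-identityʳ q))
  where
  unique : Unique (1 ∷ q ∷ [])
  unique = ((λ { refl → ¬prime[1] q-prime }) ∷ []) ∷ [] ∷ []
  ∈⇒∣ : ∀ {d} → d ∈ 1 ∷ q ∷ [] → d ∣ q
  ∈⇒∣ (here refl)         = 1∣ q
  ∈⇒∣ (there (here refl)) = ∣-refl
  ∣⇒∈ : ∀ {d} → d ∣ q → d ∈ 1 ∷ q ∷ []
  ∣⇒∈ d∣q with prime⇒irreducible q-prime d∣q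
  ... | inj₁ refl = here refl
  ... | inj₂ refl = there (here refl)

sum-map-*ˡ : ∀ a xs → sum (map (a *_) xs) ≡ a * sum xs
sum-map-*ˡ a []       = sym (*-zeroʳ a)
sum-map-*ˡ a (x ∷ xs) = trans (cong (_+_ (a * x)) (sum-map-*ˡ a xs)) (sym (*-distribˡ-+ a x (sum xs)))

sum-cartesianProduct-* : ∀ xs ys → sum (map (uncurry _*_) (cartesianProduct xs ys)) ≡ sum xs * sum ys
sum-cartesianProduct-* []       ys = refl
sum-cartesianProduct-* (x ∷ xs) ys = begin
  sum (map (uncurry _*_) (map (x ,_) ys ++ cartesianProduct xs ys))
    ≡⟨ cong sum (map-++ (uncurry _*_) (map (x ,_) ys) _) ⟩
  sum (map (uncurry _*_) (map (x ,_) ys) ++ map (uncurry _*_) (cartesianProduct xs ys))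
    ≡⟨ sum-++ (map (uncurry _*_) (map (x ,_) ys)) _ ⟩
  sum (map (uncurry _*_) (map (x ,_) ys)) + sum (map (uncurry _*_) (cartesianProduct xs ys))
    ≡⟨ cong₂ _+_ (trans (cong sum (sym (map-∘ ys))) (sum-map-*ˡ x ys)) (sum-cartesianProduct-* xs ys) ⟩
  x * sum ys + sum xs * sum ys
    ≡⟨ *-distribʳ-+ (sum ys) x (sum xs) ⟨
  (x + sum xs) * sum ys ∎
  where open ≡-Reasoning

map⁺-injectiveOn : ∀ {A B : Set} {P : A → Set} (f : A → B) →
                   (∀ {x y} → P x → P y → f x ≡ f y → x ≡ y) →
                   ∀ {xs} → All P xs → Unique xs → Unique (map f xs)
map⁺-injectiveOn f inj []         []           = []
map⁺-injectiveOn f inj (px ∷ pxs) (x∉xs ∷ xs!) =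
  All.map⁺ (All.zipWith (λ (py , x≢y) → x≢y ∘ inj px py) (pxs , x∉xs)) ∷ map⁺-injectiveOn f inj pxs xs!

∣-*-split : ∀ {d x y} .{{_ : NonZero x}} → d ∣ x * y → ∃₂ λ d₁ d₂ → d₁ ∣ x × d₂ ∣ y × d₁ * d₂ ≡ d
∣-*-split {d} {x} {y} d∣xy = g , d div g , gcd[m,n]∣n d x , d/g∣y , m*[n/m]≡n (gcd[m,n]∣m d x)
  where
  g = gcd d x
  instance
    _ : NonZero g
    _ = ≢-nonZero (gcd[m,n]≢0 d x (inj₂ (≢-nonZero⁻¹ x)))
  d/g∣x/g*y : d div g ∣ x div g * y
  d/g∣x/g*y = *-cancelˡ-∣ g (subst₂ _∣_
    (sym (m*[n/m]≡n (gcd[m,n]∣m d x)))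
    (trans (cong (_* y) (sym (m*[n/m]≡n (gcd[m,n]∣n d x)))) (*-assoc g (x div g) y))
    d∣xy)
  d/g∣y : d div g ∣ y
  d/g∣y = coprime-divisor (coprime-/gcd d x) d/g∣x/g*y

coprime-factors-unique : ∀ {x y d e d′ e′} .{{_ : NonZero x}} → Coprime x y →
  d ∣ x → e ∣ y → d′ ∣ x → e′ ∣ y → d * e ≡ d′ * e′ → d ≡ d′ × e ≡ e′
coprime-factors-unique {x} {y} {d} {e} {d′} {e′} x⊥y d∣x e∣y d′∣x e′∣y de≡d′e′ = d≡d′ , e≡e′
  where
  d≡d′ : d ≡ d′
  d≡d′ = ∣-antisym
    (coprime-divisor (λ (i∣d , i∣e′) → x⊥y (∣-trans i∣d d∣x , ∣-trans i∣e′ e′∣y))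
      (subst (d ∣_) (trans de≡d′e′ (*-comm d′ e′)) (m∣m*n e)))
    (coprime-divisor (λ (i∣d′ , i∣e) → x⊥y (∣-trans i∣d′ d′∣x , ∣-trans i∣e e∣y))
      (subst (d′ ∣_) (trans (sym de≡d′e′) (*-comm d e)) (m∣m*n e′)))
  instance
    _ : NonZero d
    _ = ≢-nonZero (λ { refl → ≢-nonZero⁻¹ x (0∣⇒≡0 d∣x) })
  e≡e′ : e ≡ e′
  e≡e′ = *-cancelˡ-≡ e e′ d (trans de≡d′e′ (cong (_* e′) (sym d≡d′)))

σ-*-coprime : ∀ x y .{{_ : NonZero x}} .{{_ : NonZero y}} → Coprime x y → σ (x * y) ≡ σ x * σ y
σ-*-coprime x y x⊥y = trans (sym (sum≡σ {{m*n≢0 x y}} unique ∈⇒∣ ∣⇒∈))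
                            (sum-cartesianProduct-* (divisors x) (divisors y))
  where
  pairs = cartesianProduct (divisors x) (divisors y)
  components : ∀ {p} → p ∈ pairs → proj₁ p ∣ x × proj₂ p ∣ y
  components p∈ with ∈-cartesianProduct⁻ (divisors x) (divisors y) p∈
  ... | d∈ , e∈ = ∈-divisors⁻ d∈ , ∈-divisors⁻ e∈
  unique : Unique (map (uncurry _*_) pairs)
  unique = map⁺-injectiveOn (uncurry _*_) injective (All.tabulate (λ p∈ → p∈))
    (Unique.cartesianProduct⁺ (divisors-unique x) (divisors-unique y))
    where
    injective : ∀ {p p′} → p ∈ pairs → p′ ∈ pairs → uncurry _*_ p ≡ uncurry _*_ p′ → p ≡ p′
    injective p∈ p′∈ eq with components p∈ | components p′∈
    ... | d∣x , e∣y | d′∣x , e′∣y = uncurry (cong₂ _,_) (coprime-factors-unique x⊥y d∣x e∣y d′∣x e′∣y eq)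
  ∈⇒∣ : ∀ {n} → n ∈ map (uncurry _*_) pairs → n ∣ x * y
  ∈⇒∣ n∈ with _ , p∈ , refl ← ∈-map⁻ (uncurry _*_) n∈ = uncurry *-pres-∣ (components p∈)
  ∣⇒∈ : ∀ {n} → n ∣ x * y → n ∈ map (uncurry _*_) pairs
  ∣⇒∈ n∣xy with d , e , d∣x , e∣y , refl ← ∣-*-split n∣xy =
    ∈-map⁺ (uncurry _*_) (∈-cartesianProduct⁺ (∈-divisors⁺ d∣x) (∈-divisors⁺ e∣y))

σ-*-prime : ∀ ℓ A {q} .{{_ : NonZero ℓ}} .{{_ : NonZero A}} → Coprime ℓ A → Prime q → ℓ * A < q →
            σ (ℓ * A * q) ≡ σ ℓ * (σ A * suc q)
σ-*-prime ℓ A {q} ℓ⊥A q-prime ℓA<q = begin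
  σ (ℓ * A * q)       ≡⟨ σ-*-coprime (ℓ * A) q {{m*n≢0 ℓ A}} {{prime⇒nonZero q-prime}} ℓA⊥q ⟩
  σ (ℓ * A) * σ q     ≡⟨ cong₂ _*_ (σ-*-coprime ℓ A ℓ⊥A) (σ-prime q-prime) ⟩
  σ ℓ * σ A * suc q   ≡⟨ *-assoc (σ ℓ) (σ A) (suc q) ⟩
  σ ℓ * (σ A * suc q) ∎
  where
  open ≡-Reasoning
  ℓA⊥q : Coprime (ℓ * A) q
  ℓA⊥q = Coprime.sym (prime⇒coprime q-prime {{m*n≢0 ℓ A}} ℓA<q)

argmax : ∀ {n} (v : Fin (suc n) → ℕ) → ∃[ j ] (∀ i → v i ≤ v j)
argmax {zero}  v = Fin.zero , λ { Fin.zero → ≤-refl }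
argmax {suc n} v with argmax (v ∘ Fin.suc)
... | j , max with v Fin.zero ≤? v (Fin.suc j)
...   | yes v₀≤vⱼ = Fin.suc j , λ { Fin.zero → v₀≤vⱼ ; (Fin.suc i) → max i }
...   | no  v₀≰vⱼ = Fin.zero , λ { Fin.zero → ≤-refl ; (Fin.suc i) → ≤-trans (max i) (<⇒≤ (≰⇒> v₀≰vⱼ)) }

sort-decreasing : ∀ {m} (v : Fin m → ℕ) → (∀ j k → v j ≡ v k → j ≡ k) →
                  Σ (Fin m → Fin m) λ π → ∀ k k′ → k Fin.< k′ → v (π k′) < v (π k)
sort-decreasing {zero}  v v-inj = (λ ()) , λ ()
sort-decreasing {suc m} v v-inj with argmax v
... | j , max with sort-decreasing (v ∘ punchIn j) (λ k k′ eq → punchIn-injective j k k′ (v-inj _ _ eq))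
...   | π , decreasing = π′ , decreasing′
  where
  π′ : Fin (suc m) → Fin (suc m)
  π′ Fin.zero    = j
  π′ (Fin.suc k) = punchIn j (π k)
  decreasing′ : ∀ k k′ → k Fin.< k′ → v (π′ k′) < v (π′ k)
  decreasing′ Fin.zero    (Fin.suc k′) _         =
    ≤∧≢⇒< (max (punchIn j (π k′))) (punchInᵢ≢i j (π k′) ∘ v-inj _ _)
  decreasing′ (Fin.suc k) (Fin.suc k′) (s≤s k<k′) = decreasing k k′ k<k′

∣prodFin∣≡1 : ∀ {K} (f : Fin K → ℤ) → (∀ i → ℤ.∣ f i ∣ ≡ 1) → ℤ.∣ prodFin f ∣ ≡ 1
∣prodFin∣≡1 {zero}  f ∣f∣≡1 = refl
∣prodFin∣≡1 {suc K} f ∣f∣≡1 = trans (ℤ.abs-* (f Fin.zero) _)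
  (cong₂ _*_ (∣f∣≡1 Fin.zero) (∣prodFin∣≡1 (f ∘ Fin.suc) (∣f∣≡1 ∘ Fin.suc)))

c*r-1≡p⇒c*s≡1+p : ∀ c r p → + c ℤ.* r ℤ.+ -1ℤ ≡ + p → ∃[ s ] (r ≡ + s × c * s ≡ suc p)
c*r-1≡p⇒c*s≡1+p c (+ s) p eq = s , refl , n-1≡p⇒n≡1+p (c * s) (trans (cong (ℤ._+ -1ℤ) (ℤ.pos-* c s)) eq)
  where
  n-1≡p⇒n≡1+p : ∀ n → + n ℤ.+ -1ℤ ≡ + p → n ≡ suc p
  n-1≡p⇒n≡1+p (suc n) refl = refl
c*r-1≡p⇒c*s≡1+p zero    -[1+ s ] p ()
c*r-1≡p⇒c*s≡1+p (suc c) -[1+ s ] p ()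

decrementForms-admissible : ∀ {t} (c : Fin t → ℕ) → (∀ i → c i ≢ 0) → (∀ i j → c i ≡ c j → i ≡ j) →
                            Admissible (λ i → + c i) (λ _ → -1ℤ)
decrementForms-admissible c c≢0 c-inj = positive , distinct , no-fixed-prime
  where
  positive : ∀ i → ℤ.+0 ℤ.< + c i
  positive i = ℤ.+<+ (n≢0⇒n>0 (c≢0 i))
  distinct : ∀ i j → i ≢ j → (+ c i , -1ℤ) ≢ (+ c j , -1ℤ)
  distinct i j i≢j eq = i≢j (c-inj i j (ℤ.+-injective (cong proj₁ eq)))
  at-zero : ∀ i → ℤ.∣ + c i ℤ.* + 0 ℤ.+ -1ℤ ∣ ≡ 1
  at-zero i rewrite ℤ.*-zeroʳ (+ c i) = refl
  no-fixed-prime : ∀ p → Prime p → ¬ (∀ n → + p ℤ.∣ prodFin (λ i → + c i ℤ.* n ℤ.+ -1ℤ))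
  no-fixed-prime p p-prime p∣values =
    ¬prime[1] (subst Prime (∣1⇒≡1 (subst (p ∣_) (∣prodFin∣≡1 _ at-zero) (p∣values (+ 0)))) p-prime)

PrimeDecrementsInfinitelyOften : ∀ {m} → (Fin m → ℕ) → Set
PrimeDecrementsInfinitelyOften c = ∀ M → ∃[ s ] (M < s × ∀ j → ∃[ q ] (Prime q × c j * s ≡ suc q))

DHL*⇒primeDecrements : ∀ {t m} (c : Fin t → ℕ) → (∀ i → c i ≢ 0) → (∀ i j → c i ≡ c j → i ≡ j) →
  1 ≤ m → DHL* t m →
  Σ (Fin m → Fin t) λ idx → (∀ j k → idx j ≡ idx k → j ≡ k) × PrimeDecrementsInfinitelyOften (c ∘ idx)
DHL*⇒primeDecrements c c≢0 c-inj 1≤m dhl with dhl _ _ (decrementForms-admissible c c≢0 c-inj)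
... | idx , idx-inj , prime-values = idx , idx-inj , primes
  where
  primes : PrimeDecrementsInfinitelyOften (c ∘ idx)
  primes M with prime-values M
  ... | r , M<∣r∣ , all-prime with all-prime (Fin.fromℕ< 1≤m)
  -- one prime value c r - 1 already forces r ≥ 0
  ...   | p₀ , _ , eq₀ with c*r-1≡p⇒c*s≡1+p (c (idx (Fin.fromℕ< 1≤m))) r p₀ eq₀
  ...     | s , refl , _ = s , M<∣r∣ , λ j → decrement j (all-prime j)
    where
    decrement : ∀ j → IsPrimeℤ (+ c (idx j) ℤ.* + s ℤ.+ -1ℤ) → ∃[ q ] (Prime q × c (idx j) * s ≡ suc q)
    decrement j (q , q-prime , eq) with c*r-1≡p⇒c*s≡1+p (c (idx j)) (+ s) q eq
    ... | _ , refl , cs≡1+q = q , q-prime , cs≡1+q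

shift-factorisation : ∀ ℓ A P s q → A ≤ P → suc P ≤ P * s → P * s ≡ A * suc q →
                      ℓ * (P * s ∸ suc P) + ℓ * (suc P ∸ A) ≡ ℓ * A * q
shift-factorisation ℓ A P s q A≤P 1+P≤Ps Ps≡A[1+q] = begin
  ℓ * (P * s ∸ suc P) + ℓ * (suc P ∸ A) ≡⟨ *-distribˡ-+ ℓ _ _ ⟨
  ℓ * (P * s ∸ suc P + (suc P ∸ A))     ≡⟨ cong (ℓ *_) (+-cancelʳ-≡ A _ _ sum+A) ⟩
  ℓ * (A * q)                           ≡⟨ *-assoc ℓ A q ⟨
  ℓ * A * q                             ∎
  where
  open ≡-Reasoning
  sum+A : P * s ∸ suc P + (suc P ∸ A) + A ≡ A * q + A
  sum+A = begin
    P * s ∸ suc P + (suc P ∸ A) + A   ≡⟨ +-assoc (P * s ∸ suc P) _ A ⟩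
    P * s ∸ suc P + (suc P ∸ A + A)   ≡⟨ cong (_+_ (P * s ∸ suc P)) (m∸n+n≡m (m≤n⇒m≤1+n A≤P)) ⟩
    P * s ∸ suc P + suc P             ≡⟨ m∸n+n≡m 1+P≤Ps ⟩
    P * s                             ≡⟨ Ps≡A[1+q] ⟩
    A * suc q                         ≡⟨ *-suc A q ⟩
    A + A * q                         ≡⟨ +-comm A (A * q) ⟩
    A * q + A                         ∎

<-shift : ∀ ℓ P s M .{{_ : NonZero ℓ}} .{{_ : NonZero P}} → M + suc P < s → M < ℓ * (P * s ∸ suc P)
<-shift ℓ P s M M+1+P<s = ≤-trans M<Ps∸1+P (m≤n*m (P * s ∸ suc P) ℓ)
  where
  s≤Ps : s ≤ P * s
  s≤Ps = m≤n*m s P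
  M<Ps∸1+P : M < P * s ∸ suc P
  M<Ps∸1+P = +-cancelʳ-< (suc P) M (P * s ∸ suc P)
    (subst (M + suc P <_) (sym (m∸n+n≡m (≤-trans (m≤n+m (suc P) M) (≤-trans (<⇒≤ M+1+P<s) s≤Ps))))
      (<-≤-trans M+1+P<s s≤Ps))

cross-multiply : ∀ S A S′ A′ Q Q′ .{{_ : NonZero A}} .{{_ : NonZero A′}} →
                 S * A′ ≡ S′ * A → A * Q ≡ A′ * Q′ → S * Q ≡ S′ * Q′
cross-multiply S A S′ A′ Q Q′ SA′≡S′A AQ≡A′Q′ = *-cancelʳ-≡ (S * Q) (S′ * Q′) (A * A′) {{m*n≢0 A A′}} (begin
  S * Q * (A * A′)         ≡⟨ rearrange S A A′ Q ⟩
  (S * A′) * (A * Q)       ≡⟨ cong₂ _*_ SA′≡S′A AQ≡A′Q′ ⟩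
  (S′ * A) * (A′ * Q′)     ≡⟨ rearrange S′ A′ A Q′ ⟨
  S′ * Q′ * (A′ * A)       ≡⟨ cong (S′ * Q′ *_) (*-comm A′ A) ⟩
  S′ * Q′ * (A * A′)       ∎)
  where
  open ≡-Reasoning
  rearrange : ∀ S A A′ Q → S * Q * (A * A′) ≡ (S * A′) * (A * Q)
  rearrange = solve-∀

1+i*P⊥divisor : ∀ i {P d} → d ∣ P → Coprime (suc (i * P)) d
1+i*P⊥divisor i {P} d∣P {e} (e∣1+iP , e∣d) =
  ∣1⇒≡1 (∣m+n∣m⇒∣n (subst (e ∣_) (+-comm 1 (i * P)) e∣1+iP) (∣n⇒∣m*n i (∣-trans e∣d d∣P)))

good-along-progression : ∀ {m} P .{{_ : NonZero P}} (a c : Fin m → ℕ) → (∀ k → NonZero (a k)) →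
  (∀ k → P ≡ c k * a k) → (∀ k k′ → σ (a k) * a k′ ≡ σ (a k′) * a k) →
  PrimeDecrementsInfinitelyOften c → ∀ i → Good (λ k → suc P ∸ a k) (suc (i * P))
good-along-progression {m} P a c a≢0 P≡ca σa-ratio primes i M with primes (M + suc P + suc (suc (i * P) * P))
... | s , s-large , decrement-prime = n , <-shift ℓ P s M M+1+P<s , σ-constant
  where
  ℓ = suc (i * P)
  n = ℓ * (P * s ∸ suc P)
  M+1+P<s : M + suc P < s
  M+1+P<s = ≤-<-trans (m≤m+n (M + suc P) (suc (ℓ * P))) s-large
  1+ℓP<s : suc (ℓ * P) < s
  1+ℓP<s = ≤-<-trans (m≤n+m (suc (ℓ * P)) (M + suc P)) s-large
  1+P≤Ps : suc P ≤ P * s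
  1+P≤Ps = ≤-trans (m≤n+m (suc P) M) (≤-trans (<⇒≤ M+1+P<s) (m≤n*m s P))
  q : Fin m → ℕ
  q k = proj₁ (decrement-prime k)
  cs≡1+q : ∀ k → c k * s ≡ suc (q k)
  cs≡1+q k = proj₂ (proj₂ (decrement-prime k))
  a∣P : ∀ k → a k ∣ P
  a∣P k = divides (c k) (P≡ca k)
  c≢0 : ∀ k → NonZero (c k)
  c≢0 k = ≢-nonZero (λ c≡0 → ≢-nonZero⁻¹ P (trans (P≡ca k) (cong (_* a k) c≡0)))
  a[1+q]≡Ps : ∀ k → a k * suc (q k) ≡ P * s
  a[1+q]≡Ps k = begin
    a k * suc (q k)  ≡⟨ cong (a k *_) (cs≡1+q k) ⟨
    a k * (c k * s)  ≡⟨ *-assoc (a k) (c k) s ⟨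
    a k * c k * s    ≡⟨ cong (_* s) (trans (*-comm (a k) (c k)) (sym (P≡ca k))) ⟩
    P * s            ∎
    where open ≡-Reasoning
  ℓa<q : ∀ k → ℓ * a k < q k
  ℓa<q k = ≤-<-trans (*-monoʳ-≤ ℓ (∣⇒≤ (a∣P k)))
    (≤-pred (<-≤-trans 1+ℓP<s (subst (s ≤_) (cs≡1+q k) (m≤n*m s (c k) {{c≢0 k}}))))
  σ-value : ∀ k → σ (n + ℓ * (suc P ∸ a k)) ≡ σ ℓ * (σ (a k) * suc (q k))
  σ-value k = trans
    (cong σ (shift-factorisation ℓ (a k) P s (q k) (∣⇒≤ (a∣P k)) 1+P≤Ps (sym (a[1+q]≡Ps k))))
    (σ-*-prime ℓ (a k) {{_}} {{a≢0 k}} (1+i*P⊥divisor i (a∣P k)) (proj₁ (proj₂ (decrement-prime k))) (ℓa<q k))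
  σ-constant : ∀ k k′ → σ (n + ℓ * (suc P ∸ a k)) ≡ σ (n + ℓ * (suc P ∸ a k′))
  σ-constant k k′ = begin
    σ (n + ℓ * (suc P ∸ a k))          ≡⟨ σ-value k ⟩
    σ ℓ * (σ (a k) * suc (q k))         ≡⟨ cong (σ ℓ *_) (cross-multiply (σ (a k)) (a k) (σ (a k′)) (a k′) _ _ {{a≢0 k}} {{a≢0 k′}}
                                            (σa-ratio k k′) (trans (a[1+q]≡Ps k) (sym (a[1+q]≡Ps k′)))) ⟩
    σ ℓ * (σ (a k′) * suc (q k′))       ≡⟨ σ-value k′ ⟨
    σ (n + ℓ * (suc P ∸ a k′))         ∎
    where open ≡-Reasoning

progression-count : ∀ P .{{_ : NonZero P}} N → ∃[ k ] ((∀ i → i < k → i * P < N) × N ≤ P * k)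
progression-count P zero = 0 , (λ _ ()) , z≤n
progression-count P (suc N) with progression-count P N
... | k , below , N≤Pk with suc N ≤? P * k
...   | yes 1+N≤Pk = k , (λ i i<k → m≤n⇒m≤1+n (below i i<k)) , 1+N≤Pk
...   | no  1+N≰Pk = suc k , below′ , 1+N≤P[1+k]
  where
  Pk≡N : P * k ≡ N
  Pk≡N = ≤-antisym (≤-pred (≰⇒> 1+N≰Pk)) N≤Pk
  below′ : ∀ i → i < suc k → i * P < suc N
  below′ i i<1+k = s≤s (subst (i * P ≤_) (trans (*-comm k P) Pk≡N) (*-monoˡ-≤ P (≤-pred i<1+k)))
  1+N≤P[1+k] : suc N ≤ P * suc k
  1+N≤P[1+k] = subst (suc N ≤_) (sym (trans (*-suc P k) (cong (_+_ P) Pk≡N)))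
    (+-monoˡ-≤ N (n≢0⇒n>0 (≢-nonZero⁻¹ P)))

progression⇒PosLowerDensity : ∀ P .{{_ : NonZero P}} {S : ℕ → Set} → (∀ i → S (suc (i * P))) → PosLowerDensity S
progression⇒PosLowerDensity P {S} S-progression = pred P , 0 , λ N _ → witness N
  where
  witness : ∀ N → ∃[ L ] (Unique L × All (λ ℓ → 1 ≤ ℓ × ℓ ≤ N × S ℓ) L × N ≤ suc (pred P) * length L)
  witness N with progression-count P N
  ... | k , below , N≤Pk = L , Unique.map⁺ injective (Unique.upTo⁺ k) , All.tabulate member , N≤P*|L|
    where
    L = map (λ i → suc (i * P)) (upTo k)
    injective : ∀ {i j} → suc (i * P) ≡ suc (j * P) → i ≡ j
    injective eq = *-cancelʳ-≡ _ _ P (suc-injective eq)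
    member : ∀ {ℓ} → ℓ ∈ L → 1 ≤ ℓ × ℓ ≤ N × S ℓ
    member ℓ∈L with i , i∈ , refl ← ∈-map⁻ (λ i → suc (i * P)) ℓ∈L = s≤s z≤n , below i (∈-upTo⁻ i∈) , S-progression i
    N≤P*|L| : N ≤ suc (pred P) * length L
    N≤P*|L| = subst (N ≤_) (sym (cong₂ _*_ (suc-pred P) (trans (length-map _ (upTo k)) (length-upTo k)))) N≤Pk

theorem5 : (m t : ℕ) → 2 ≤ m → m ≤ t → DHL* t m →
    (y : ℚ) (a : Fin t → ℕ) (apos : ∀ i → NonZero (a i)) →
    (∀ i j → a i ≡ a j → i ≡ j) →
    (∀ i → _/_ (+ σ (a i)) (a i) {{apos i}} ≡ y) →
    ∃[ h ] ((∀ i → 1 ≤ h i) × (∀ (i j : Fin m) → i Fin.< j → h i < h j)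
      × PosLowerDensity (Good h))
theorem5 m t 2≤m _ dhl y a a≢0 a-inj σa/a≡y = h , h≥1 , h-increasing , density
  where
  P = product (tabulate a)
  instance
    _ : NonZero P
    _ = product≢0 (All.tabulate⁺ a≢0)
  a∣P : ∀ i → a i ∣ P
  a∣P i = ∈⇒∣product (∈-tabulate⁺ i)
  c : Fin t → ℕ
  c i = quotient (a∣P i)
  P≡ca : ∀ i → P ≡ c i * a i
  P≡ca i = m∣n⇒n≡quotient*m (a∣P i)
  c≢0 : ∀ i → c i ≢ 0
  c≢0 i c≡0 = ≢-nonZero⁻¹ P (trans (P≡ca i) (cong (_* a i) c≡0))
  c-inj : ∀ i j → c i ≡ c j → i ≡ j
  c-inj i j ci≡cj = a-inj i j (*-cancelˡ-≡ (a i) (a j) (c i) {{≢-nonZero (c≢0 i)}}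
    (trans (sym (P≡ca i)) (trans (P≡ca j) (cong (_* a j) (sym ci≡cj)))))
  σa-ratio : ∀ i j → σ (a i) * a j ≡ σ (a j) * a i
  σa-ratio i j = normalize-injective-≃ (σ (a i)) (σ (a j)) (a i) (a j) {{a≢0 i}} {{a≢0 j}} (trans (σa/a≡y i) (sym (σa/a≡y j)))
  chosen = DHL*⇒primeDecrements c c≢0 c-inj (≤-trans (s≤s z≤n) 2≤m) dhl
  idx = proj₁ chosen
  sorted = sort-decreasing (a ∘ idx) (λ j k → proj₁ (proj₂ chosen) j k ∘ a-inj _ _)
  g = idx ∘ proj₁ sorted
  primes : PrimeDecrementsInfinitelyOften (c ∘ g)
  primes M with proj₂ (proj₂ chosen) M
  ... | s , M<s , decrement-prime = s , M<s , decrement-prime ∘ proj₁ sorted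
  h : Fin m → ℕ
  h k = suc P ∸ a (g k)
  h≥1 : ∀ k → 1 ≤ h k
  h≥1 k = subst (1 ≤_) (sym (+-∸-assoc 1 (∣⇒≤ (a∣P (g k))))) (s≤s z≤n)
  h-increasing : ∀ i j → i Fin.< j → h i < h j
  h-increasing i j i<j = ∸-monoʳ-< (proj₂ sorted i j i<j) (m≤n⇒m≤1+n (∣⇒≤ (a∣P (g i))))
  density : PosLowerDensity (Good h)
  density = progression⇒PosLowerDensity P
    (good-along-progression P (a ∘ g) (c ∘ g) (a≢0 ∘ g) (P≡ca ∘ g) (λ k k′ → σa-ratio (g k) (g k′)) primes)
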